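{- Consider any execution of the procedure Explore described below on a finite unfolding $\mathfrak U$. For any maximal configuration $C$ of $\mathfrak U$ there is at most one node $(\tilde C,\tilde D,\tilde A,\tilde e)$ of the call graph with $\tilde C=C$.
   Context: $\mathfrak U=(E,<,\#,h)$ is a finite labelled event structure (causality $<$ a strict partial order, conflict $\#$ symmetric irreflexive and inherited along $<$) with a minimal event $\bot$ (the unfolding of a system under an independence relation); a configuration is a finite causally closed conflict-free set of events; $[e]=\{e'\le e\}$, $\lceil e\rceil=\{e'<e\}$; $e\#_ie'$ if $e\#e'$ and both $\lceil e\rceil\cup[e']$ and $[e]\cup\lceil e'\rceil$ are configurations. $\mathrm{ex}(C)=\{e\notin C:\lceil e\rceil\subseteq C\}$, $\mathrm{en}(C)=\{e\in\mathrm{ex}(C):C\cup\{e\}\text{ a configuration}\}$. For $U\subseteq E$, $\#_U(e)=\{e'\in U:e\#_ie'\}$, $Q_{C,D,U}=C\cup D\cup\bigcup_{e\in C\cup D,\,e'\in\#_U(e)}[e']$. An alternative to $D$ after $C$ (w.r.t. $U$) is a configuration $J\subseteq U$ with $C\cup J$ a configuration and, for each $e\in D$, some $e'\in C\cup J$ in $\#_U(e)$; $\mathrm{Alt}(X,Y)$ is the set of all alternatives to $Y$ after $X$ w.r.t. the current $U$. Algorithm: global $U$ (initially $\{\bot\}$), $G$ (initially $\emptyset$); start with $\mathrm{Explore}(\{\bot\},\emptyset,\emptyset)$. $\mathrm{Explore}(C,D,A)$: (1) add $\mathrm{ex}(C)$ to $U$; (2) if $\mathrm{en}(C)\cap U=\emptyset$,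 return; (3) if $A=\emptyset$ choose any $e\in\mathrm{en}(C)\cap U$, else any $e\in A\cap\mathrm{en}(C)\cap U$; (4) call $\mathrm{Explore}(C\cup\{e\},D,A\setminus\{e\})$; (5) if some $J\in\mathrm{Alt}(C,D\cup\{e\})$ exists, call $\mathrm{Explore}(C,D\cup\{e\},J\setminus C)$; (6) move $\{e\}\setminus Q_{C,D,U}$ from $U$ to $G$ and, for each $\hat e\in\#_U(e)$, move $[\hat e]\setminus Q_{C,D,U}$ from $U$ to $G$. Call graph: nodes are tuples $(C,D,A,e)$ such that $\mathrm{Explore}(C,D,A)$ was called and $e$ is the event chosen in step (3) (or $\bot$ if the call returned at step (2)). -}

module Defs where

open import Data.Nat using (ℕ)
open import Data.Fin using (Fin)
open import Data.Fin.Subset using (Subset; _∈_; _∉_; _⊆_; _∪_; _─_; ⁅_⁆)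
open import Data.Product using (_×_; _,_; ∃; ∃₂)
open import Data.Sum using (_⊎_)
open import Data.List using (List; []; _∷_; _++_)
open import Relation.Nullary using (¬_; Dec)
open import Relation.Binary.PropositionalEquality using (_≡_; _≢_)
open import Function.Bundles using (_⇔_)

record EventStructure (n : ℕ) (L : Set) : Set₁ where
  field
    _≺_      : Fin n → Fin n → Set
    _#_      : Fin n → Fin n → Set
    h        : Fin n → L
    bot      : Fin n
    ≺-irrefl : ∀ {e} → ¬ (e ≺ e)
    ≺-trans  : ∀ {e e' e''} → e ≺ e' → e' ≺ e'' → e ≺ e''
    #-sym    : ∀ {e e'} → e # e' → e' # e
    #-irrefl : ∀ {e} → ¬ (e # e)
    #-inh    : ∀ {e e' e''} → e # e' → e' ≺ e'' → e # e''
    bot-min  : ∀ e → e ≢ bot → bot ≺ e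
    ≺-dec    : ∀ e e' → Dec (e ≺ e')
    #-dec    : ∀ e e' → Dec (e # e')

record Node (n : ℕ) : Set where
  constructor node
  field
    nC : Subset n
    nD : Subset n
    nA : Subset n
    ne : Fin n

module Semantics {n : ℕ} {L : Set} (ES : EventStructure n L) where
  open EventStructure ES

  _≼_ : Fin n → Fin n → Set
  x ≼ e = x ≺ e ⊎ x ≡ e

  -- configuration, for a set given by a membership predicate
  -- (finiteness is automatic since there are finitely many events)
  IsConfigP : (Fin n → Set) → Set
  IsConfigP P = (∀ {e e'} → P e → e' ≺ e → P e')
              × (∀ {e e'} → P e → P e' → ¬ (e # e'))

  IsConfig : Subset n → Set
  IsConfig C = IsConfigP (_∈ C)

  IsMaximalConfig : Subset n → Set
  IsMaximalConfig C = IsConfig C × (∀ C' → IsConfig C' → C ⊆ C' → C' ≡ C)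

  _#ᵢ_ : Fin n → Fin n → Set
  e #ᵢ e' = e # e'
          × IsConfigP (λ x → x ≺ e ⊎ x ≼ e')
          × IsConfigP (λ x → x ≼ e ⊎ x ≺ e')

  InEx : Subset n → Fin n → Set
  InEx C e = e ∉ C × (∀ x → x ≺ e → x ∈ C)

  InEn : Subset n → Fin n → Set
  InEn C e = InEx C e × IsConfigP (λ x → x ∈ C ⊎ x ≡ e)

  InConfU : Subset n → Fin n → Fin n → Set
  InConfU U e e' = e' ∈ U × e #ᵢ e'

  InQ : Subset n → Subset n → Subset n → Fin n → Set
  InQ C D U x = x ∈ C ⊎ x ∈ D
              ⊎ ∃₂ λ e e' → (e ∈ C ⊎ e ∈ D) × InConfU U e e' × x ≼ e'

  IsAlt : Subset n → Subset n → Subset n → Subset n → Set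
  IsAlt U C D J = J ⊆ U × IsConfig J × IsConfigP (λ x → x ∈ C ⊎ x ∈ J)
                × (∀ e → e ∈ D → ∃ λ e' → (e' ∈ C ⊎ e' ∈ J) × InConfU U e e')

  IsEmpty : Subset n → Set
  IsEmpty A = ∀ x → x ∉ A

  -- x is moved from U to G in step (6) (chosen event e, current U):
  -- x ∈ ({e} ∪ ⋃_{ê ∈ #_U(e)} [ê]) \ Q_{C,D,U}
  Removed : Subset n → Subset n → Subset n → Fin n → Fin n → Set
  Removed C D U e x = (x ≡ e ⊎ ∃ λ ê → InConfU U e ê × x ≼ ê) × ¬ InQ C D U x

  -- Big-step semantics of Explore(C,D,A) with global state (U,G):
  -- Exec C D A U G U' G' ns : the call Explore(C,D,A), started with global
  -- state (U,G), can terminate with global state (U',G'), and ns lists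
  -- (in preorder) the call-graph nodes of this call and all its sub-calls.
  data Exec : Subset n → Subset n → Subset n → Subset n → Subset n
            → Subset n → Subset n → List (Node n) → Set
  data Step5 : Subset n → Subset n → Subset n → Subset n
             → Subset n → Subset n → List (Node n) → Set

  data Exec where
    ret  : ∀ {C D A U G U₁} →
           (∀ x → (x ∈ U₁) ⇔ (x ∈ U ⊎ InEx C x)) →
           (∀ e → InEn C e → e ∉ U₁) →
           Exec C D A U G U₁ G (node C D A bot ∷ [])
    step : ∀ {C D A U G U₁ U₂ G₂ U₃ G₃ U₄ G₄ e ns₁ ns₂} →
           (∀ x → (x ∈ U₁) ⇔ (x ∈ U ⊎ InEx C x)) →
           InEn C e → e ∈ U₁ → (IsEmpty A ⊎ e ∈ A) →
           Exec (C ∪ ⁅ e ⁆) D (A ─ ⁅ e ⁆) U₁ G U₂ G₂ ns₁ →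
           Step5 C (D ∪ ⁅ e ⁆) U₂ G₂ U₃ G₃ ns₂ →
           (∀ x → (x ∈ U₄) ⇔ (x ∈ U₃ × ¬ Removed C D U₃ e x)) →
           (∀ x → (x ∈ G₄) ⇔ (x ∈ G₃ ⊎ (x ∈ U₃ × Removed C D U₃ e x))) →
           Exec C D A U G U₄ G₄ (node C D A e ∷ (ns₁ ++ ns₂))

  data Step5 where
    alt   : ∀ {C D' U₂ G₂ U₃ G₃ J ns} →
            IsAlt U₂ C D' J →
            Exec C D' (J ─ C) U₂ G₂ U₃ G₃ ns →
            Step5 C D' U₂ G₂ U₃ G₃ ns
    noalt : ∀ {C D' U₂ G₂} →
            (∀ J → ¬ IsAlt U₂ C D' J) →
            Step5 C D' U₂ G₂ U₂ G₂ []

-- Along a call Explore(C, D, A) every event of D conflicts with an event of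
-- C ∪ A and lies outside A.  Hence the event e chosen in step (3) is not in D,
-- and every node of the call graph below Explore(C, D, A) has a configuration
-- C' with C ⊆ C' and C' ∩ D ⊆ C.  The nodes below step (4) thus contain e,
-- while those below step (5), where e has been added to D, do not; so two
-- nodes carrying the same configuration lie in the same subtree.  The root
-- itself carries C, which has the enabled event e and so is not maximal.
module Submission where

open import Defs
open import Data.Nat using (ℕ)
open import Data.Fin.Subset using (Subset; ⁅_⁆) renaming (⊥ to ∅)
open import Data.List using (List)
open import Data.List.Membership.Propositional using () renaming (_∈_ to _∈ₗ_)
open import Relation.Binary.PropositionalEquality using (_≡_)

open import Data.Fin using (_≟_)
open import Data.Fin.Subset using (_∈_; _∉_; _⊆_; _∪_; _─_)
open import Data.Fin.Subset.Properties
  using (x∈p∪q⁺; x∈p∪q⁻; x∈⁅x⁆; x∈⁅y⁆⇒x≡y; p─q⊆p; x∈p∧x∉q⇒x∈p─q; ∉⊥; _∈?_)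
open import Data.Product using (_×_; _,_; ∃; proj₁)
open import Data.Sum using (_⊎_; inj₁; inj₂)
open import Data.Empty using (⊥-elim)
open import Data.List using ([]; _∷_; _++_)
open import Data.List.Relation.Unary.All as All using (All; []; _∷_)
open import Data.List.Relation.Unary.All.Properties using (++⁺)
open import Data.List.Relation.Unary.Any using (here; there)
open import Data.List.Membership.Propositional.Properties using (∈-++⁻)
open import Relation.Nullary using (¬_; yes; no)
open import Relation.Binary.PropositionalEquality using (_≢_; refl; sym; trans; subst)

module _ {n : ℕ} where

  open Node

  x∈p∪⁅y⁆⁻ : ∀ {p : Subset n} {x y} → x ∈ p ∪ ⁅ y ⁆ → x ∈ p ⊎ x ≡ y
  x∈p∪⁅y⁆⁻ {p} {y = y} x∈ with x∈p∪q⁻ p ⁅ y ⁆ x∈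
  ... | inj₁ x∈p = inj₁ x∈p
  ... | inj₂ x∈y = inj₂ (x∈⁅y⁆⇒x≡y y x∈y)

  x∈p∪⁅y⁆⁺ : ∀ {p : Subset n} {x y} → x ∈ p ⊎ x ≡ y → x ∈ p ∪ ⁅ y ⁆
  x∈p∪⁅y⁆⁺ (inj₁ x∈p)  = x∈p∪q⁺ (inj₁ x∈p)
  x∈p∪⁅y⁆⁺ (inj₂ refl) = x∈p∪q⁺ (inj₂ (x∈⁅x⁆ _))

  y∈p∪⁅y⁆ : ∀ {p : Subset n} y → y ∈ p ∪ ⁅ y ⁆
  y∈p∪⁅y⁆ y = x∈p∪⁅y⁆⁺ (inj₂ refl)

  record Confined (C D : Subset n) (x : Node n) : Set where
    constructor confined
    field
      ⊆nC    : C ⊆ nC x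
      D∩nC⊆C : ∀ {d} → d ∈ D → d ∈ nC x → d ∈ C

  confined-self : ∀ {C D} x → nC x ≡ C → Confined C D x
  confined-self x refl = confined (λ p → p) (λ _ p → p)

  confined-∪⁅⁆ˡ : ∀ {C D e x} → e ∉ D → Confined (C ∪ ⁅ e ⁆) D x → Confined C D x
  confined-∪⁅⁆ˡ {C} {D} {x = x} e∉D (confined C∪e⊆ D∩⊆) =
    confined (λ p → C∪e⊆ (x∈p∪q⁺ (inj₁ p))) D∩⊆C
    where
    D∩⊆C : ∀ {d} → d ∈ D → d ∈ nC x → d ∈ C
    D∩⊆C d∈D d∈x with x∈p∪⁅y⁆⁻ (D∩⊆ d∈D d∈x)
    ... | inj₁ d∈C = d∈C
    ... | inj₂ refl = ⊥-elim (e∉D d∈D)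

  confined-∪⁅⁆ʳ : ∀ {C D e x} → Confined C (D ∪ ⁅ e ⁆) x → Confined C D x
  confined-∪⁅⁆ʳ (confined C⊆ D∩⊆) = confined C⊆ (λ d∈D → D∩⊆ (x∈p∪q⁺ (inj₁ d∈D)))

  confined-∪⁅⁆ˡ⇒∈ : ∀ {C D e x} → Confined (C ∪ ⁅ e ⁆) D x → e ∈ nC x
  confined-∪⁅⁆ˡ⇒∈ c = Confined.⊆nC c (y∈p∪⁅y⁆ _)

  confined-∪⁅⁆ʳ⇒∉ : ∀ {C D e x} → e ∉ C → Confined C (D ∪ ⁅ e ⁆) x → e ∉ nC x
  confined-∪⁅⁆ʳ⇒∉ e∉C c e∈x = e∉C (Confined.D∩nC⊆C c (y∈p∪⁅y⁆ _) e∈x)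

  UniqueAt : Subset n → List (Node n) → Set
  UniqueAt M ns = ∀ x y → x ∈ₗ ns → y ∈ₗ ns → nC x ≡ M → nC y ≡ M → x ≡ y

  uniqueAt-[] : ∀ {M} → UniqueAt M []
  uniqueAt-[] _ _ ()

  uniqueAt-[_] : ∀ {M} x → UniqueAt M (x ∷ [])
  uniqueAt-[ x ] _ _ (here refl) (here refl) _ _ = refl

  uniqueAt-∷ : ∀ {M x ns} → nC x ≢ M → UniqueAt M ns → UniqueAt M (x ∷ ns)
  uniqueAt-∷ x≢M _  _ _ (here refl) _          cx _  = ⊥-elim (x≢M cx)
  uniqueAt-∷ x≢M _  _ _ _           (here refl) _ cy = ⊥-elim (x≢M cy)
  uniqueAt-∷ _   uq x y (there x∈)  (there y∈)  cx cy = uq x y x∈ y∈ cx cy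

  uniqueAt-++ : ∀ {M ns₁ ns₂} e →
                All (λ x → e ∈ nC x) ns₁ → All (λ x → e ∉ nC x) ns₂ →
                UniqueAt M ns₁ → UniqueAt M ns₂ → UniqueAt M (ns₁ ++ ns₂)
  uniqueAt-++ {ns₁ = ns₁} e in₁ out₂ uq₁ uq₂ x y x∈ y∈ cx cy
    with ∈-++⁻ ns₁ x∈ | ∈-++⁻ ns₁ y∈
  ... | inj₁ x∈₁ | inj₁ y∈₁ = uq₁ x y x∈₁ y∈₁ cx cy
  ... | inj₂ x∈₂ | inj₂ y∈₂ = uq₂ x y x∈₂ y∈₂ cx cy
  ... | inj₁ x∈₁ | inj₂ y∈₂ =
    ⊥-elim (All.lookup out₂ y∈₂ (subst (e ∈_) (trans cx (sym cy)) (All.lookup in₁ x∈₁)))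
  ... | inj₂ x∈₂ | inj₁ y∈₁ =
    ⊥-elim (All.lookup out₂ x∈₂ (subst (e ∈_) (trans cy (sym cx)) (All.lookup in₁ y∈₁)))

module _ {n : ℕ} {L : Set} (ES : EventStructure n L) where

  open EventStructure ES
  open Semantics ES

  InEn⇒IsConfig-∪⁅⁆ : ∀ {C e} → InEn C e → IsConfig (C ∪ ⁅ e ⁆)
  InEn⇒IsConfig-∪⁅⁆ (_ , closed , conflictFree) =
      (λ x∈ y≺x → x∈p∪⁅y⁆⁺ (closed (x∈p∪⁅y⁆⁻ x∈) y≺x))
    , (λ x∈ y∈ → conflictFree (x∈p∪⁅y⁆⁻ x∈) (x∈p∪⁅y⁆⁻ y∈))

  IsMaximalConfig⇒¬InEn : ∀ {C e} → IsMaximalConfig C → ¬ InEn C e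
  IsMaximalConfig⇒¬InEn {C} {e} (_ , maximal) en@((e∉C , _) , _) =
    e∉C (subst (e ∈_) C∪e≡C (y∈p∪⁅y⁆ e))
    where
    C∪e≡C : C ∪ ⁅ e ⁆ ≡ C
    C∪e≡C = maximal _ (InEn⇒IsConfig-∪⁅⁆ en) (λ p → x∈p∪q⁺ (inj₁ p))

  Excludes : Subset n → Subset n → Subset n → Set
  Excludes C A D = ∀ {d} → d ∈ D → (∃ λ e' → (e' ∈ C ⊎ e' ∈ A) × d # e') × d ∉ A

  excludes-∅ : ∀ {C A} → Excludes C A ∅
  excludes-∅ d∈∅ = ⊥-elim (∉⊥ d∈∅)

  excludes-step : ∀ {C A D e} → Excludes C A D → Excludes (C ∪ ⁅ e ⁆) (A ─ ⁅ e ⁆) D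
  excludes-step {C} {A} {e = e} excl d∈D with excl d∈D
  ... | (e' , e'∈ , d#e') , d∉A = (e' , moved e'∈ , d#e') , λ d∈ → d∉A (p─q⊆p A ⁅ e ⁆ d∈)
    where
    moved : e' ∈ C ⊎ e' ∈ A → e' ∈ C ∪ ⁅ e ⁆ ⊎ e' ∈ A ─ ⁅ e ⁆
    moved (inj₁ e'∈C) = inj₁ (x∈p∪q⁺ (inj₁ e'∈C))
    moved (inj₂ e'∈A) with e' ≟ e
    ... | yes refl = inj₁ (y∈p∪⁅y⁆ e)
    ... | no e'≢e  = inj₂ (x∈p∧x∉q⇒x∈p─q e'∈A (λ e'∈e → e'≢e (x∈⁅y⁆⇒x≡y e e'∈e)))

  excludes-alt : ∀ {U C D J} → IsAlt U C D J → Excludes C (J ─ C) D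
  excludes-alt {C = C} {J = J} (_ , _ , (_ , conflictFree) , alternative) d∈D
    with alternative _ d∈D
  ... | e' , e'∈ , _ , d#e' , _ = (e' , moved e'∈ , d#e') , d∉J─C
    where
    moved : e' ∈ C ⊎ e' ∈ J → e' ∈ C ⊎ e' ∈ J ─ C
    moved (inj₁ e'∈C) = inj₁ e'∈C
    moved (inj₂ e'∈J) with e' ∈? C
    ... | yes e'∈C = inj₁ e'∈C
    ... | no e'∉C  = inj₂ (x∈p∧x∉q⇒x∈p─q e'∈J e'∉C)
    d∉J─C : _ ∉ J ─ C
    d∉J─C d∈ = conflictFree (inj₂ (p─q⊆p J C d∈)) e'∈ d#e'

  chosen∉D : ∀ {C A D e} → Excludes C A D → InEn C e → (IsEmpty A ⊎ e ∈ A) → e ∉ D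
  chosen∉D excl (_ , _ , conflictFree) choice e∈D with excl e∈D | choice
  ... | (_ , inj₁ e'∈C , e#e') , _ | _        = conflictFree (inj₂ refl) (inj₁ e'∈C) e#e'
  ... | (_ , inj₂ e'∈A , _)    , _ | inj₁ A∅  = A∅ _ e'∈A
  ... | _                     , e∉A | inj₂ e∈A = e∉A e∈A

  mutual
    exec-confined : ∀ {C D A U G U' G' ns} → Excludes C A D →
                    Exec C D A U G U' G' ns → All (Confined C D) ns
    exec-confined _ (ret _ _) = confined-self _ refl ∷ []
    exec-confined excl (step _ en _ choice left right _ _) =
      confined-self _ refl
      ∷ ++⁺ (All.map (confined-∪⁅⁆ˡ (chosen∉D excl en choice))
                     (exec-confined (excludes-step excl) left))
            (All.map confined-∪⁅⁆ʳ (step5-confined right))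

    step5-confined : ∀ {C D U G U' G' ns} →
                     Step5 C D U G U' G' ns → All (Confined C D) ns
    step5-confined (alt isAlt ex) = exec-confined (excludes-alt isAlt) ex
    step5-confined (noalt _)      = []

  mutual
    exec-uniqueAt : ∀ {M C D A U G U' G' ns} → IsMaximalConfig M → Excludes C A D →
                    Exec C D A U G U' G' ns → UniqueAt M ns
    exec-uniqueAt _ _ (ret _ _) = uniqueAt-[ _ ]
    exec-uniqueAt maxM excl (step {e = e} _ en _ _ left right _ _) =
      uniqueAt-∷ (λ { refl → IsMaximalConfig⇒¬InEn maxM en })
        (uniqueAt-++ e
          (All.map confined-∪⁅⁆ˡ⇒∈ (exec-confined (excludes-step excl) left))
          (All.map (confined-∪⁅⁆ʳ⇒∉ (proj₁ (proj₁ en))) (step5-confined right))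
          (exec-uniqueAt maxM (excludes-step excl) left)
          (step5-uniqueAt maxM right))

    step5-uniqueAt : ∀ {M C D U G U' G' ns} → IsMaximalConfig M →
                     Step5 C D U G U' G' ns → UniqueAt M ns
    step5-uniqueAt maxM (alt isAlt ex) = exec-uniqueAt maxM (excludes-alt isAlt) ex
    step5-uniqueAt _    (noalt _)      = uniqueAt-[]

lemma11 : ∀ {n : ℕ} {L : Set} (ES : EventStructure n L) →
    ∀ {U' G' : Subset n} {ns : List (Node n)} →
    Semantics.Exec ES ⁅ EventStructure.bot ES ⁆ ∅ ∅ ⁅ EventStructure.bot ES ⁆ ∅ U' G' ns →
    ∀ (C : Subset n) → Semantics.IsMaximalConfig ES C →
    ∀ (x y : Node n) → x ∈ₗ ns → y ∈ₗ ns →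
    Node.nC x ≡ C → Node.nC y ≡ C → x ≡ y
lemma11 ES ex C maxC = exec-uniqueAt ES maxC (excludes-∅ ES) ex
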